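{- Let $\mathcal{I}$ be an instance (of the basic or extended version) and $\mathcal{I}'$ the associated instance defined in the context. If there exists a balanced feasible assignment $f'$ for $\mathcal{I}'$, then there exists a balanced feasible assignment $f$ for $\mathcal{I}$. Moreover, if $f'$ is periodic, then $f$ can be chosen periodic with the same period as $f'$.
   Context: Tasks: $n$ intervals $[s_i,e_i)\subseteq(-1,1)$, $i\in[n]$, with $e_i\in(0,1]$, $e_i-s_i\le 1$; the $r$th occurrence of task $i$ occupies $[s_i+r,e_i+r)$; workers are $[q]$. $U(\mathcal{I})=\{i: s_i\le 0\}$. A schedule is a pair $(T,W)$ with $T\subseteq[n]$ and $W=\varnothing$ or $W=\{i\}$, $i\in U(\mathcal{I})$; non-overlapping if for all $i'\in T$: $[s_{i'},e_{i'})\cap[s_{i''},e_{i''})=\varnothing$ for $i''\in T\setminus\{i'\}$ and $[s_{i'},e_{i'})\cap[s_i+1,e_i+1)=\varnothing$ for $i\in W$. An extended instance is $\bigl(([s_i,e_i))_{i\in[n]},q,\mathcal{S}\bigr)$ with $\mathcal{S}$ a set of non-overlapping schedules; a basic instance is the case where $\mathcal{S}$ is all non-overlapping schedules. An assignment $f:[n]\times\mathbb{Z}_{>0}\to[q]$ induces, for worker $j$ and week $r$, the schedule $(\{i: f(i,r)=j\},\{i\in U(\mathcal{I}): f(i,r+1)=j\})$; $f$ is feasible if all induced schedules lie in $\mathcal{S}$; balanced if for all $i,j$, $\lim_{t\to\infty}\frac1t|\{r\in[t]:f(i,r)=j\}|$ exists and equals $1/q$; periodic with period $h$ if $f(i,r)=f(i,r+h)$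 for all $i,r$. Construction of $\mathcal{I}'$ (requires $|U(\mathcal{I})|\le q$): $n'=n+q-|U(\mathcal{I})|$; fictitious tasks $i\in\{n+1,\dots,n'\}$ with $[s_i,e_i)=[0,\varepsilon)$ where $0<\varepsilon\le\min(\{s_i: i\in[n]\setminus U(\mathcal{I})\}\cup\{s_i+1:i\in U(\mathcal{I})\})$; same $q$; $\mathcal{S}'$ consists of, for each $(T,W)\in\mathcal{S}$, all pairs $(T',W')$ with $T'=T$ if $T\cap U(\mathcal{I})\ne\varnothing$, $T'=T\cup\{i\}$ for some fictitious $i$ otherwise, and $W'=W$ if $W\ne\varnothing$, $W'=\{i\}$ for some fictitious $i$ otherwise.
   Formalization: The interval endpoints $s_i$, $e_i$ of the instance and the number $\varepsilon$ in the construction of the associated instance are taken in the rationals rather than the reals. -}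

module Defs where

open import Data.Nat as ℕ using (ℕ; zero; suc; NonZero; _∸_)
open import Data.Integer using (+_)
open import Data.Rational using (ℚ; 0ℚ; 1ℚ; _/_; _-_; _≤_; _<_) renaming (_+_ to _+ℚ_; ∣_∣ to absℚ)
open import Data.Rational.Properties using (_≤?_)
open import Data.Fin using (Fin; splitAt; _≟_)
open import Data.Fin.Subset using (Subset; ⁅_⁆; _∩_; Nonempty; Empty; _∈_; inside)
  renaming (⊥ to ∅; ∣_∣ to card)
open import Data.Vec using (tabulate; _++_)
open import Data.Bool using (Bool; _∧_; if_then_else_)
open import Data.Sum using (_⊎_; [_,_])
open import Data.Product using (Σ; ∃; ∃-syntax; _×_)
open import Relation.Nullary using (¬_)
open import Relation.Nullary.Decidable using (⌊_⌋)
open import Relation.Binary.PropositionalEquality using (_≡_; _≢_)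

Disjoint : ℚ → ℚ → ℚ → ℚ → Set
Disjoint s e s' e' = ∀ (x : ℚ) → ¬ ((s ≤ x × x < e) × (s' ≤ x × x < e'))

Uset : {n : ℕ} → (Fin n → ℚ) → Subset n
Uset s = tabulate (λ i → ⌊ s i ≤? 0ℚ ⌋)

WShape : {n : ℕ} → (Fin n → ℚ) → Subset n → Set
WShape s W = (W ≡ ∅) ⊎ (Σ _ λ i → (W ≡ ⁅ i ⁆) × (s i ≤ 0ℚ))

NonOverlapping : {n : ℕ} → (Fin n → ℚ) → (Fin n → ℚ) → Subset n → Subset n → Set
NonOverlapping {n} s e T W =
  WShape s W ×
  (∀ (i' : Fin n) → i' ∈ T →
     (∀ (i'' : Fin n) → i'' ∈ T → i'' ≢ i' → Disjoint (s i') (e i') (s i'') (e i'')) ×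
     (∀ (i : Fin n) → i ∈ W → Disjoint (s i') (e i') (s i +ℚ 1ℚ) (e i +ℚ 1ℚ)))

-- Extended instances (a basic instance is the special case where S is
-- the set of all non-overlapping schedules)

record Instance : Set₁ where
  field
    n     : ℕ
    q     : ℕ
    s     : Fin n → ℚ
    e     : Fin n → ℚ
    s>-1  : ∀ i → (0ℚ - 1ℚ) < s i
    e>0   : ∀ i → 0ℚ < e i
    e≤1   : ∀ i → e i ≤ 1ℚ
    len≤1 : ∀ i → (e i - s i) ≤ 1ℚ
    S     : Subset n → Subset n → Set
    S-nonoverlapping : ∀ T W → S T W → NonOverlapping s e T W

-- Assignments.  Week r ∈ ℤ_{>0} is represented by k : ℕ with r = k + 1,
-- so f i k is the worker of the (k+1)-th week of task i.

Assignment : ℕ → ℕ → Set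
Assignment n q = Fin n → ℕ → Fin q

inducedT : {n q : ℕ} → Assignment n q → Fin q → ℕ → Subset n
inducedT f j k = tabulate (λ i → ⌊ f i k ≟ j ⌋)

inducedW : {n q : ℕ} → (Fin n → ℚ) → Assignment n q → Fin q → ℕ → Subset n
inducedW s f j k = tabulate (λ i → ⌊ s i ≤? 0ℚ ⌋ ∧ ⌊ f i (suc k) ≟ j ⌋)

Feasible : {n q : ℕ} → (Fin n → ℚ) → (Subset n → Subset n → Set) → Assignment n q → Set
Feasible {n} {q} s S f = ∀ (j : Fin q) (k : ℕ) → S (inducedT f j k) (inducedW s f j k)

count : {n q : ℕ} → Assignment n q → Fin n → Fin q → ℕ → ℕ
count f i j zero    = 0
count f i j (suc t) = count f i j t ℕ.+ (if ⌊ f i t ≟ j ⌋ then 1 else 0)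

ConvergesTo : (ℕ → ℚ) → ℚ → Set
ConvergesTo a L = ∀ (ε : ℚ) → 0ℚ < ε → ∃[ N ] (∀ m → N ℕ.≤ m → absℚ (a m - L) < ε)

-- lim_{t→∞} (1/t) count(t) = 1/q  (sequence indexed by t = m + 1)
Balanced : {n q : ℕ} → .{{_ : NonZero q}} → Assignment n q → Set
Balanced {n} {q} f = ∀ (i : Fin n) (j : Fin q) →
  ConvergesTo (λ m → (+ count f i j (suc m)) / suc m) ((+ 1) / q)

Periodic : {n q : ℕ} → Assignment n q → ℕ → Set
Periodic f h = ∀ i r → f i r ≡ f i (r ℕ.+ h)

-- Tasks of I' are Fin (n + k) with
-- k = q ∸ |U(I)|; the first n are the original tasks (splitAt gives inj₁),
-- the last k are the fictitious tasks with interval [0, ε).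

module Prime (I : Instance) where
  open Instance I

  k : ℕ
  k = q ∸ card (Uset s)

  n' : ℕ
  n' = n ℕ.+ k

  s' : Fin n' → ℚ
  s' x = [ s , (λ _ → 0ℚ) ] (splitAt n x)

  e' : ℚ → Fin n' → ℚ
  e' ε x = [ e , (λ _ → ε) ] (splitAt n x)

  ValidEps : ℚ → Set
  ValidEps ε = (0ℚ < ε) ×
    (∀ i → ((0ℚ < s i) → ε ≤ s i) × (s i ≤ 0ℚ → ε ≤ s i +ℚ 1ℚ))

  FictRel : Subset n → Subset k → Set
  FictRel A F = (Nonempty A × F ≡ ∅) ⊎ (Empty A × ∃[ x ] (F ≡ ⁅ x ⁆))

  S' : Subset n' → Subset n' → Set
  S' T' W' = ∃[ T ] ∃[ W ] ∃[ FT ] ∃[ FW ]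
    S T W × FictRel (T ∩ Uset s) FT × FictRel W FW ×
    T' ≡ T ++ FT × W' ≡ W ++ FW

{-# OPTIONS --safe #-}
-- The balanced feasible assignment for I is the restriction of f' to the original
-- tasks.  Every schedule of S' is a schedule (T, W) ∈ S padded with fictitious tasks,
-- so dropping the fictitious tasks from the schedules induced by f' gives back
-- schedules in S; balance and periodicity hold task by task and so survive the
-- restriction.
module Submission where

open import Defs
open import Data.Nat using (ℕ; NonZero; _≤_; zero; suc; _+_)
open import Data.Integer using (+_)
open import Data.Rational using (ℚ; 0ℚ; _/_; _-_; _<_) renaming (∣_∣ to absℚ)
open import Data.Rational.Properties using (_≤?_)
open import Data.Fin using (Fin; _↑ˡ_; _↑ʳ_; _≟_)
open import Data.Fin.Properties using (splitAt-↑ˡ)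
open import Data.Fin.Subset using () renaming (∣_∣ to card)
open import Data.Vec using (Vec; tabulate; _++_; _∷_)
open import Data.Vec.Properties using (++-injectiveˡ; tabulate-cong)
open import Data.Bool using (Bool; _∧_; if_then_else_)
open import Data.Sum using ([_,_])
open import Data.Product using (_×_; _,_; ∃-syntax)
open import Relation.Nullary.Decidable using (⌊_⌋)
open import Relation.Binary.PropositionalEquality
  using (_≡_; _≗_; refl; sym; trans; cong; subst; subst₂)
open import Function using (_∘_)

private
  variable
    A : Set
    m l p w : ℕ

tabulate-++ : ∀ m (g : Fin (m + l) → A) →
  tabulate g ≡ tabulate (g ∘ (_↑ˡ l)) ++ tabulate (g ∘ (m ↑ʳ_))
tabulate-++ zero    g = refl
tabulate-++ (suc m) g = cong (g Fin.zero ∷_) (tabulate-++ m (g ∘ Fin.suc))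

tabulate-↑ˡ-prefix : (g : Fin (m + l) → A) {xs : Vec A m} {ys : Vec A l} →
  tabulate g ≡ xs ++ ys → tabulate (g ∘ (_↑ˡ l)) ≡ xs
tabulate-↑ˡ-prefix {m = m} g eq =
  ++-injectiveˡ _ _ (trans (sym (tabulate-++ m g)) eq)

convergesTo-resp-≗ : ∀ {a b : ℕ → ℚ} {L} →
  a ≗ b → ConvergesTo a L → ConvergesTo b L
convergesTo-resp-≗ {L = L} a≗b conv ε ε>0 with conv ε ε>0
... | N , close = N , λ t N≤t → subst (λ x → absℚ (x - L) < ε) (a≗b t) (close t N≤t)

count-∘ : ∀ (f : Assignment p w) (ι : Fin m → Fin p) i j t →
  count f (ι i) j t ≡ count (f ∘ ι) i j t
count-∘ f ι i j zero    = refl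
count-∘ f ι i j (suc t) =
  cong (_+ (if ⌊ f (ι i) t ≟ j ⌋ then 1 else 0)) (count-∘ f ι i j t)

balanced-∘ : .{{_ : NonZero w}} (f : Assignment p w) (ι : Fin m → Fin p) →
  Balanced f → Balanced (f ∘ ι)
balanced-∘ f ι bal i j =
  convergesTo-resp-≗ (λ t → cong (λ c → (+ c) / suc t) (count-∘ f ι i j (suc t)))
                     (bal (ι i) j)

inducedT-↑ˡ : ∀ (f : Assignment (p + l) w) j r {T FT} →
  inducedT f j r ≡ T ++ FT → inducedT (f ∘ (_↑ˡ l)) j r ≡ T
inducedT-↑ˡ f j r = tabulate-↑ˡ-prefix (λ x → ⌊ f x r ≟ j ⌋)

inducedW-↑ˡ : ∀ {s : Fin p → ℚ} {s⁺ : Fin (p + l) → ℚ} →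
  (∀ i → s⁺ (i ↑ˡ l) ≡ s i) →
  ∀ (f : Assignment (p + l) w) j r {W FW} →
  inducedW s⁺ f j r ≡ W ++ FW → inducedW s (f ∘ (_↑ˡ l)) j r ≡ W
inducedW-↑ˡ {p = p} {l = l} {s⁺ = s⁺} s⁺-↑ˡ f j r eq =
  trans (tabulate-cong (λ i → cong (λ x → ⌊ x ≤? 0ℚ ⌋ ∧ next i) (sym (s⁺-↑ˡ i))))
        (tabulate-↑ˡ-prefix inW⁺ eq)
  where
  inW⁺ : Fin (p + l) → Bool
  inW⁺ x = ⌊ s⁺ x ≤? 0ℚ ⌋ ∧ ⌊ f x (suc r) ≟ j ⌋
  next : Fin p → Bool
  next i = ⌊ f (i ↑ˡ l) (suc r) ≟ j ⌋

open Instance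
open Prime

s'-↑ˡ : ∀ (I : Instance) i → s' I (i ↑ˡ k I) ≡ s I i
s'-↑ˡ I i = cong [ s I , _ ] (splitAt-↑ˡ (n I) i (k I))

feasible-↑ˡ : ∀ (I : Instance) (f' : Assignment (n' I) (q I)) →
  Feasible (s' I) (S' I) f' → Feasible (s I) (S I) (f' ∘ (_↑ˡ k I))
feasible-↑ˡ I f' feasible j r with feasible j r
... | T , W , _ , _ , TW∈S , _ , _ , T'≡T++FT , W'≡W++FW =
  subst₂ (S I) (sym (inducedT-↑ˡ f' j r T'≡T++FT))
               (sym (inducedW-↑ˡ (s'-↑ˡ I) f' j r W'≡W++FW)) TW∈S

lemma2p4 : (I : Instance) → .{{_ : NonZero (q I)}} → card (Uset (s I)) ≤ q I →
    (ε : ℚ) → ValidEps I ε →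
    (f' : Assignment (n' I) (q I)) → Feasible (s' I) (S' I) f' → Balanced f' →
      (∃[ f ] (Feasible (s I) (S I) f × Balanced f)) ×
      (∀ (h : ℕ) → Periodic f' h →
        ∃[ f ] (Feasible (s I) (S I) f × Balanced f × Periodic f h))
lemma2p4 I _ _ _ f' feasible balanced =
  (f , f-feasible , f-balanced) ,
  λ h periodic → f , f-feasible , f-balanced , periodic ∘ ι
  where
  ι : Fin (n I) → Fin (n' I)
  ι = _↑ˡ k I
  f : Assignment (n I) (q I)
  f = f' ∘ ι
  f-feasible : Feasible (s I) (S I) f
  f-feasible = feasible-↑ˡ I f' feasible
  f-balanced : Balanced f
  f-balanced = balanced-∘ f' ι balanced
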